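{- For any maximization problem in the class Asymmetric Online Covering (AOC), the online algorithm $\textsc{Greedy}$, which accepts the current request if and only if adding it to the set of requests accepted so far keeps that set feasible, has online bounded ratio $1$. In particular, $\textsc{Greedy}$ has online bounded ratio $1$ (and hence is optimal with respect to online bounded analysis) for Online Independent Set in the vertex-arrival model, Unweighted Matching in the edge-arrival model, and Online Disjoint Path Allocation where requests are paths.
   Context: Online problem: requests arrive one at a time and each must be irrevocably handled before the next is revealed. An online accept-reject problem is one in which the algorithm must accept or reject each request. A maximization accept-reject problem is in AOC if, for the set $Y$ of accepted requests, the objective value is $|Y|$ if $Y$ is feasible and $-\infty$ otherwise, and every subset of a feasible set is feasible. Online bounded analysis: for a deterministic online algorithm $A$ of a maximization problem, $\textsc{Opt}_A$ denotes an offline algorithm that is optimal among offline algorithms whose solution on any input $I$ satisfies, for every prefix $I'$ of $I$, that the value of the solution restricted to $I'$ is at least $A(I')$. The online bounded ratio of $A$ is the supremum of all constants $c$ such that $A(I) \ge c\,\textsc{Opt}_A(I)$ for all inputs $I$ (so it is at most $1$). In Online Independent Set (vertex-arrival), vertices of a graph arrive with their edges to earlier vertices and the accepted set must be independent; in Unweighted Matching (edge-arrival), edges arrive and the accepted edges must form a matching; in Online Disjoint Path Allocation, requests are paths in a graph and accepted paths must be edge-disjoint. -}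

module Defs where

open import Level using (Level; suc; _⊔_)
open import Data.Bool using (Bool; true; false; if_then_else_)
open import Data.Nat using (ℕ; _≤_; z≤n)
open import Data.List using (List; []; _∷_; _++_; [_]; length; take; zip; drop)
open import Data.Product using (Σ; _×_; proj₁; proj₂; _,_)
open import Data.Sum using (_⊎_)
open import Relation.Nullary using (Dec; yes; no; does; ¬_)
open import Relation.Unary using (Decidable)
open import Relation.Binary.PropositionalEquality using (_≡_; _≢_)
open import Data.List.Relation.Binary.Sublist.Propositional using (_⊆_)
open import Data.List.Relation.Unary.AllPairs using (AllPairs)
open import Data.List.Relation.Unary.Linked using (Linked)
open import Data.List.Relation.Unary.Unique.Propositional using (Unique)
open import Data.List.Membership.Propositional using (_∈_; _∉_)

-- A set of accepted requests is
-- represented by the sub-list of the input consisting of the accepted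
-- requests (in arrival order).

data Val : Set where
  -∞  : Val
  fin : ℕ → Val

data _≤V_ : Val → Val → Set where
  -∞≤     : ∀ {v} → -∞ ≤V v
  fin≤fin : ∀ {m n} → m ≤ n → fin m ≤V fin n

record AOC (R : Set) : Set₁ where
  field
    Feasible : List R → Set
    subset-closed : ∀ {xs ys : List R} → xs ⊆ ys → Feasible ys → Feasible xs

module _ {R : Set} (Feasible : List R → Set) (dec : Decidable Feasible) where

  value : List R → Val
  value Y with dec Y
  ... | yes _ = fin (length Y)
  ... | no  _ = -∞

select : {R : Set} → List R → List Bool → List R
select []       _            = []
select (_ ∷ _)  []           = []
select (r ∷ rs) (true  ∷ bs) = r ∷ select rs bs
select (r ∷ rs) (false ∷ bs) = select rs bs

-- A deterministic online accept-reject algorithm: the decision on the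
-- current request is a function of the previously revealed requests
-- (its own earlier decisions are determined by these) and the current
-- request.
OnlineAlg : Set → Set
OnlineAlg R = List R → R → Bool

runFrom : {R : Set} → OnlineAlg R → List R → List R → List Bool
runFrom A hist []       = []
runFrom A hist (r ∷ rs) = A hist r ∷ runFrom A (hist ++ [ r ]) rs

run : {R : Set} → OnlineAlg R → List R → List Bool
run A I = runFrom A [] I

module _ {R : Set} {Feasible : List R → Set} (dec : Decidable Feasible) where

  greedyAccFrom : List R → List R → List R
  greedyAccFrom acc []       = acc
  greedyAccFrom acc (r ∷ rs) =
    if does (dec (acc ++ [ r ])) then greedyAccFrom (acc ++ [ r ]) rs
                                 else greedyAccFrom acc rs

  greedyAccepted : List R → List R
  greedyAccepted = greedyAccFrom []

  Greedy : OnlineAlg R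
  Greedy hist r = does (dec (greedyAccepted hist ++ [ r ]))

-- Online bounded ratio 1.
-- An offline solution s (one decision per request) is admissible for
-- Opt_A on input I if on every prefix I' of I its value is at least A(I').
-- Opt_A(I) is the maximum value of admissible solutions, so
-- "A(I) ≥ 1 · Opt_A(I) for all I" says every admissible solution has
-- value at most A(I).  Since the online bounded ratio is always ≤ 1,
-- the ratio equals 1 exactly when this holds.
module _ {R : Set} (Feasible : List R → Set) (dec : Decidable Feasible) where

  algValue : OnlineAlg R → List R → Val
  algValue A I = value Feasible dec (select I (run A I))

  Admissible : OnlineAlg R → List R → List Bool → Set
  Admissible A I s =
    length s ≡ length I ×
    (∀ k → k ≤ length I →
       algValue A (take k I) ≤V value Feasible dec (select (take k I) (take k s)))

  OnlineBoundedRatioOne : OnlineAlg R → Set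
  OnlineBoundedRatioOne A =
    ∀ (I : List R) (s : List Bool) → Admissible A I s →
      value Feasible dec (select I s) ≤V algValue A I

-- Online Independent Set, vertex-arrival: a request is a vertex name
-- together with the list of (earlier) vertices it is adjacent to.
IndepSetFeasible : (V : Set) → List (V × List V) → Set
IndepSetFeasible V = AllPairs (λ u v → proj₁ u ∉ proj₂ v × proj₁ v ∉ proj₂ u)

MatchingFeasible : (V : Set) → List (V × V) → Set
MatchingFeasible V = AllPairs (λ e f →
  proj₁ e ≢ proj₁ f × proj₁ e ≢ proj₂ f × proj₂ e ≢ proj₁ f × proj₂ e ≢ proj₂ f)

Path : (V : Set) → (V → V → Set) → Set
Path V Adj = Σ (List V) (λ p → Linked Adj p × Unique p)

pathEdges : {V : Set} → List V → List (V × V)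
pathEdges p = zip p (drop 1 p)

SameEdge : {V : Set} → V × V → V × V → Set
SameEdge (a , b) (c , d) = (a ≡ c × b ≡ d) ⊎ (a ≡ d × b ≡ c)

EdgeDisjoint : {V : Set} → List V → List V → Set
EdgeDisjoint p q = ∀ {e f} → e ∈ pathEdges p → f ∈ pathEdges q → ¬ SameEdge e f

DisjointPathFeasible : (V : Set) (Adj : V → V → Set) → List (Path V Adj) → Set
DisjointPathFeasible V Adj = AllPairs (λ p q → EdgeDisjoint (proj₁ p) (proj₁ q))

-- Let A be Greedy's accepted set on a prefix P of the input (A is feasible
-- whenever the empty set is) and let r be the next request.  If A ++ [ r ] is
-- feasible, Greedy accepts and reaches |A| + 1, while rejecting would leave
-- only |A|; if it is infeasible, Greedy rejects and keeps |A|, while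
-- accepting would give -∞.  So an offline solution that agrees with Greedy
-- on P and is at least as good as Greedy on P ++ [ r ] must take Greedy's
-- decision on r (`greedy-choice-forced`).  By induction along the input, an
-- admissible solution for Opt_Greedy coincides with Greedy's decisions
-- (`admissible-follows-greedy`), so its value equals Greedy's.  If the empty
-- set is infeasible, subset-closure makes every set infeasible and all
-- values are -∞.  Independent Set, Matching and Disjoint Path Allocation are
-- "pairwise compatible" problems (AllPairs of a relation), hence in AOC.
module Submission where

open import Defs
open import Data.Bool using (Bool; true; false)
open import Data.Nat using (suc; _≤_; s≤s; z≤n)
open import Data.Nat.Properties using (≤-refl; m+1+n≰m; suc-injective)
open import Data.List using (List; []; _∷_; _++_; [_]; length; take)
open import Data.List.Properties using (++-assoc; ++-identityʳ; length-++)
open import Data.Product using (_×_; _,_)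
open import Data.Empty using (⊥-elim)
open import Relation.Nullary using (yes; no; does; ¬_)
open import Relation.Unary using (Decidable)
open import Relation.Binary.PropositionalEquality
  using (_≡_; refl; sym; trans; cong; cong₂; subst; subst₂; module ≡-Reasoning)
open import Data.List.Relation.Binary.Sublist.Propositional using (_⊆_; []; _∷_; _∷ʳ_; minimum)
open import Data.List.Relation.Binary.Sublist.Propositional.Properties using (All-resp-⊆)
open import Data.List.Relation.Unary.AllPairs using (AllPairs; []; _∷_)

AllPairs-resp-⊆ : {A : Set} {Rel : A → A → Set} {xs ys : List A} →
                  xs ⊆ ys → AllPairs Rel ys → AllPairs Rel xs
AllPairs-resp-⊆ []             []       = []
AllPairs-resp-⊆ (_ ∷ʳ xs⊆ys)   (_ ∷ ps) = AllPairs-resp-⊆ xs⊆ys ps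
AllPairs-resp-⊆ (refl ∷ xs⊆ys) (p ∷ ps) = All-resp-⊆ xs⊆ys p ∷ AllPairs-resp-⊆ xs⊆ys ps

select-∷ : {R : Set} (r : R) (b : Bool) (rs : List R) (bs : List Bool) →
           select [ r ] [ b ] ++ select rs bs ≡ select (r ∷ rs) (b ∷ bs)
select-∷ r true  rs bs = refl
select-∷ r false rs bs = refl

≤V-refl : (v : Val) → v ≤V v
≤V-refl -∞      = -∞≤
≤V-refl (fin n) = fin≤fin ≤-refl

module _ {R : Set} {Feasible : List R → Set} (dec : Decidable Feasible) where

  private
    val : List R → Val
    val = value Feasible dec

  value-feasible : {X : List R} → Feasible X → val X ≡ fin (length X)
  value-feasible {X} fX with dec X
  ... | yes _  = refl
  ... | no ¬fX = ⊥-elim (¬fX fX)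

  value-infeasible : {X : List R} → ¬ Feasible X → val X ≡ -∞
  value-infeasible {X} ¬fX with dec X
  ... | yes fX = ⊥-elim (¬fX fX)
  ... | no _   = refl

  value-rejected : {A : List R} → Feasible A → val (A ++ []) ≡ fin (length A)
  value-rejected {A} fA = trans (cong val (++-identityʳ A)) (value-feasible fA)

  greedyStep : List R → R → List R
  greedyStep A r = A ++ select [ r ] [ does (dec (A ++ [ r ])) ]

  greedyStep-feasible : {A : List R} (r : R) → Feasible A → Feasible (greedyStep A r)
  greedyStep-feasible {A} r fA with dec (A ++ [ r ])
  ... | yes fAr = fAr
  ... | no _    = subst Feasible (sym (++-identityʳ A)) fA

  greedy-choice-forced : (A : List R) → Feasible A → (r : R) (b : Bool) →
    val (greedyStep A r) ≤V val (A ++ select [ r ] [ b ]) → b ≡ does (dec (A ++ [ r ]))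
  greedy-choice-forced A fA r b greedy≤b with dec (A ++ [ r ]) | b
  ... | yes _   | true  = refl
  ... | no _    | false = refl
  ... | yes fAr | false with subst₂ _≤V_ (value-feasible fAr) (value-rejected fA) greedy≤b
  ...   | fin≤fin |Ar|≤|A| = ⊥-elim (m+1+n≰m (length A) (subst (_≤ length A) (length-++ A) |Ar|≤|A|))
  greedy-choice-forced A fA r b greedy≤b | no ¬fAr | true
    with subst₂ _≤V_ (value-rejected fA) (value-infeasible ¬fAr) greedy≤b
  ... | ()

  greedyAccFrom-snoc : (acc rs : List R) (r : R) →
    greedyAccFrom dec acc (rs ++ [ r ]) ≡ greedyStep (greedyAccFrom dec acc rs) r
  greedyAccFrom-snoc acc [] r with does (dec (acc ++ [ r ]))
  ... | true  = refl
  ... | false = sym (++-identityʳ acc)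
  greedyAccFrom-snoc acc (x ∷ rs) r with does (dec (acc ++ [ x ]))
  ... | true  = greedyAccFrom-snoc (acc ++ [ x ]) rs r
  ... | false = greedyAccFrom-snoc acc rs r

  greedyAccepted-++ : (h rs : List R) →
    greedyAccepted dec (h ++ rs) ≡ greedyAccepted dec h ++ select rs (runFrom (Greedy dec) h rs)
  greedyAccepted-++ h [] = trans (cong (greedyAccepted dec) (++-identityʳ h)) (sym (++-identityʳ _))
  greedyAccepted-++ h (r ∷ rs) = begin
    greedyAccepted dec (h ++ r ∷ rs)                ≡⟨ cong (greedyAccepted dec) (sym (++-assoc h [ r ] rs)) ⟩
    greedyAccepted dec ((h ++ [ r ]) ++ rs)         ≡⟨ greedyAccepted-++ (h ++ [ r ]) rs ⟩
    greedyAccepted dec (h ++ [ r ]) ++ S            ≡⟨ cong (_++ S) (greedyAccFrom-snoc [] h r) ⟩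
    (A ++ select [ r ] [ Greedy dec h r ]) ++ S     ≡⟨ ++-assoc A _ S ⟩
    A ++ (select [ r ] [ Greedy dec h r ] ++ S)     ≡⟨ cong (A ++_) (select-∷ r (Greedy dec h r) rs _) ⟩
    A ++ select (r ∷ rs) (runFrom (Greedy dec) h (r ∷ rs)) ∎
    where
    open ≡-Reasoning
    A = greedyAccepted dec h
    S = select rs (runFrom (Greedy dec) (h ++ [ r ]) rs)

  -- The offline decisions s for the remaining input rs after history h are,
  -- on every prefix of rs, at least as good as Greedy.  For h = [] this is
  -- the admissibility condition of Opt_Greedy.
  DominatesGreedyAfter : List R → List R → List Bool → Set
  DominatesGreedyAfter h rs s = ∀ k → k ≤ length rs →
    val (greedyAccepted dec (h ++ take k rs)) ≤V val (greedyAccepted dec h ++ select (take k rs) (take k s))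

  admissible-follows-greedy : (h rs : List R) (s : List Bool) → Feasible (greedyAccepted dec h) →
    length s ≡ length rs → DominatesGreedyAfter h rs s → s ≡ runFrom (Greedy dec) h rs
  admissible-follows-greedy h []       []      fA len dom = refl
  admissible-follows-greedy h (r ∷ rs) (b ∷ s) fA len dom =
    cong₂ _∷_ b≡greedy (admissible-follows-greedy (h ++ [ r ]) rs s fA′ (suc-injective len) dom′)
    where
    A = greedyAccepted dec h

    snoc : greedyAccepted dec (h ++ [ r ]) ≡ greedyStep A r
    snoc = greedyAccFrom-snoc [] h r

    b≡greedy : b ≡ Greedy dec h r
    b≡greedy = greedy-choice-forced A fA r b (subst (λ X → val X ≤V val (A ++ select [ r ] [ b ])) snoc (dom 1 (s≤s z≤n)))

    fA′ : Feasible (greedyAccepted dec (h ++ [ r ]))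
    fA′ = subst Feasible (sym snoc) (greedyStep-feasible r fA)

    regroup : (xs : List R) (bs : List Bool) →
      A ++ select (r ∷ xs) (b ∷ bs) ≡ greedyAccepted dec (h ++ [ r ]) ++ select xs bs
    regroup xs bs = begin
      A ++ select (r ∷ xs) (b ∷ bs)              ≡⟨ cong (A ++_) (sym (select-∷ r b xs bs)) ⟩
      A ++ (select [ r ] [ b ] ++ select xs bs)   ≡⟨ sym (++-assoc A _ _) ⟩
      (A ++ select [ r ] [ b ]) ++ select xs bs   ≡⟨ cong (λ c → (A ++ select [ r ] [ c ]) ++ select xs bs) b≡greedy ⟩
      greedyStep A r ++ select xs bs              ≡⟨ cong (_++ select xs bs) (sym snoc) ⟩
      greedyAccepted dec (h ++ [ r ]) ++ select xs bs ∎
      where open ≡-Reasoning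

    dom′ : DominatesGreedyAfter (h ++ [ r ]) rs s
    dom′ k k≤ = subst₂ (λ X Y → val X ≤V val Y)
      (cong (greedyAccepted dec) (sym (++-assoc h [ r ] (take k rs)))) (regroup (take k rs) (take k s))
      (dom (suc k) (s≤s k≤))

  greedy-bounded-ratio-one : (∀ {xs ys : List R} → xs ⊆ ys → Feasible ys → Feasible xs) →
    OnlineBoundedRatioOne Feasible dec (Greedy dec)
  greedy-bounded-ratio-one subset-closed I s (len , admissible) with dec []
  ... | no ¬f[] = subst (_≤V algValue Feasible dec (Greedy dec) I)
                        (sym (value-infeasible (λ fX → ¬f[] (subset-closed (minimum _) fX)))) -∞≤
  ... | yes f[] = subst (λ t → val (select I t) ≤V algValue Feasible dec (Greedy dec) I)
                        (sym s≡greedy) (≤V-refl _)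
    where
    dominates : DominatesGreedyAfter [] I s
    dominates k k≤ = subst (_≤V val (select (take k I) (take k s)))
                           (cong val (sym (greedyAccepted-++ [] (take k I)))) (admissible k k≤)

    s≡greedy : s ≡ run (Greedy dec) I
    s≡greedy = admissible-follows-greedy [] I s f[] len dominates

theorem1 :
    (∀ (R : Set) (P : AOC R) (dec : Decidable (AOC.Feasible P)) →
       OnlineBoundedRatioOne (AOC.Feasible P) dec (Greedy dec))
    × (∀ (V : Set) (dec : Decidable (IndepSetFeasible V)) →
         OnlineBoundedRatioOne (IndepSetFeasible V) dec (Greedy dec))
    × (∀ (V : Set) (dec : Decidable (MatchingFeasible V)) →
         OnlineBoundedRatioOne (MatchingFeasible V) dec (Greedy dec))
    × (∀ (V : Set) (Adj : V → V → Set) (dec : Decidable (DisjointPathFeasible V Adj)) →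
         OnlineBoundedRatioOne (DisjointPathFeasible V Adj) dec (Greedy dec))
theorem1 =
    (λ R P dec → greedy-bounded-ratio-one dec (AOC.subset-closed P))
  , (λ V dec → greedy-bounded-ratio-one dec AllPairs-resp-⊆)
  , (λ V dec → greedy-bounded-ratio-one dec AllPairs-resp-⊆)
  , (λ V Adj dec → greedy-bounded-ratio-one dec AllPairs-resp-⊆)
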